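{- $\tilde r\le \mathtt w\cdot(\mathtt h''+1)$, where $\mathtt h''$ is the number of indices $i$ with $1\le i<\mathtt h$ and $S_i\ne S_{i+1}$.
   Context: Let $S_1,\dots,S_{\mathtt h}$ be strings (haplotypes), not necessarily distinct, each of length $\mathtt w$ over the ordered alphabet $\{0,\dots,\sigma-1\}$. The prefix array $\mathrm{PA}$ is the $\mathtt h\times\mathtt w$ matrix whose column 1 is $1,\dots,\mathtt h$ and whose column $j>1$ lists the indices $k$ sorted by the co-lexicographic order (comparison from the last symbol backwards) of $S_k[1..j-1]$, ties broken by increasing $k$. The PBWT is the $\mathtt h\times\mathtt w$ matrix with $\mathrm{PBWT}[i][j]=S_{\mathrm{PA}[i][j]}[j]$. A run of column $j$ is a maximal block of consecutive rows with identical symbols in that column of the PBWT; $r_j$ is the number of runs of column $j$ and $\tilde r=\sum_{j=1}^{\mathtt w} r_j$. -}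

module Defs where

open import Data.Nat using (ℕ; zero; suc; _+_; _*_)
open import Data.Bool using (Bool; true; false; if_then_else_; _∨_; _∧_)
open import Data.Fin using (Fin; toℕ; _<?_; _≤?_)
open import Data.Fin.Properties using () renaming (_≟_ to _≟F_)
open import Data.Nat.ListAction using (sum)
open import Data.List using (List; []; _∷_; map; reverse; take; allFin)
open import Data.Vec using (Vec; lookup; toList)
open import Data.List.Properties using () renaming (≡-dec to ≡-decL)
open import Data.Vec.Properties using () renaming (≡-dec to ≡-decV)
open import Relation.Nullary using (Dec; yes; no)
open import Relation.Nullary.Decidable using (⌊_⌋)
open import Relation.Binary.Definitions using (DecidableEquality)

-- Haplotypes S_1..S_h, each a string of length w over {0..σ-1};
-- indices are 0-based here: S_k = lookup S k, S_k[j] = lookup (lookup S k) j.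
Haplotypes : ℕ → ℕ → ℕ → Set
Haplotypes σ h w = Vec (Vec (Fin σ) w) h

changesFrom : {A : Set} → DecidableEquality A → A → List A → ℕ
changesFrom _≟_ x [] = 0
changesFrom _≟_ x (y ∷ ys) = (if ⌊ x ≟ y ⌋ then 0 else 1) + changesFrom _≟_ y ys

changes : {A : Set} → DecidableEquality A → List A → ℕ
changes _≟_ [] = 0
changes _≟_ (x ∷ xs) = changesFrom _≟_ x xs

runs : {A : Set} → DecidableEquality A → List A → ℕ
runs _≟_ [] = 0
runs _≟_ (x ∷ xs) = suc (changes _≟_ (x ∷ xs))

lexLt : {σ : ℕ} → List (Fin σ) → List (Fin σ) → Bool
lexLt [] [] = false
lexLt [] (_ ∷ _) = true
lexLt (_ ∷ _) [] = false
lexLt (x ∷ xs) (y ∷ ys) = ⌊ x <? y ⌋ ∨ (⌊ x ≟F y ⌋ ∧ lexLt xs ys)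

-- reversed prefix S_k[1..j-1] (columns strictly before column j, 0-based j);
-- lex order on reversed strings = co-lexicographic order on the strings.
revPrefix : {σ w : ℕ} → Vec (Fin σ) w → Fin w → List (Fin σ)
revPrefix v j = reverse (take (toℕ j) (toList v))

module _ {σ h w : ℕ} (S : Haplotypes σ h w) (j : Fin w) where
  key : Fin h → List (Fin σ)
  key k = revPrefix (lookup S k) j

  before : Fin h → Fin h → Bool
  before k k' = lexLt (key k) (key k') ∨ (⌊ ≡-decL _≟F_ (key k) (key k') ⌋ ∧ ⌊ k ≤? k' ⌋)

  insert : Fin h → List (Fin h) → List (Fin h)
  insert x [] = x ∷ []
  insert x (y ∷ ys) = if before x y then x ∷ y ∷ ys else y ∷ insert x ys

  isort : List (Fin h) → List (Fin h)
  isort [] = []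
  isort (x ∷ xs) = insert x (isort xs)

  PAcol : List (Fin h)
  PAcol = isort (allFin h)

  PBWTcol : List (Fin σ)
  PBWTcol = map (λ k → lookup (lookup S k) j) PAcol

  rcol : ℕ
  rcol = runs _≟F_ PBWTcol

rTilde : {σ h w : ℕ} → Haplotypes σ h w → ℕ
rTilde {w = w} S = sum (map (rcol S) (allFin w))

h'' : {σ h w : ℕ} → Haplotypes σ h w → ℕ
h'' S = changes (≡-decV _≟F_) (toList S)

{-# OPTIONS --safe #-}
module Submission where

-- In column j the prefix array sorts the indices by (reversed prefix, index). If S_i = S_{i+1},
-- the indices i and i+1 have equal keys, so nothing sorts strictly between them and i+1
-- directly follows i in the column. Call such a pair a link. Along the index order the links
-- and the h'' changes together account for all h - 1 adjacent pairs; along the prefix array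
-- every link occupies an adjacent pair without a change of haplotype, so there are at most
-- h - 1 - #links = h'' changes of haplotype, and the PBWT symbol can only change where the
-- haplotype does. Hence r_j ≤ h'' + 1 for every column.

open import Data.Bool using (T; true; false; if_then_else_)
open import Data.Empty using (⊥)
open import Data.Fin as Fin using (Fin; zero; suc; inject₁; toℕ)
open import Data.Fin.Properties as Fin using (toℕ-inject₁)
open import Data.List using (List; []; _∷_; map; tabulate; allFin; length)
open import Data.List.Membership.Propositional using (_∈_; _∉_)
open import Data.List.Membership.Propositional.Properties using (∈-allFin)
open import Data.List.Properties using (map-tabulate; length-tabulate; map-∘) renaming (≡-dec to ≡-decL)
open import Data.List.Relation.Binary.Infix.Heterogeneous using (Infix; here; there)
open import Data.List.Relation.Binary.Lex.Strict as Lex using (Lex-<; halt; this; next)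
open import Data.List.Relation.Binary.Permutation.Propositional using (_↭_; ↭-sym; ↭⇒↭ₛ)
open import Data.List.Relation.Binary.Permutation.Propositional.Properties
  using (¬x∷xs↭[]; ↭-length; map⁺; ∈-resp-↭)
import Data.List.Relation.Binary.Permutation.Setoid.Properties as PermutationSetoid
open import Data.List.Relation.Binary.Pointwise using (≡⇒Pointwise-≡; Pointwise-≡⇒≡)
open import Data.List.Relation.Binary.Prefix.Heterogeneous using ([]; _∷_)
open import Data.List.Relation.Unary.All as All using (_∷_)
open import Data.List.Relation.Unary.All.Properties using (All¬⇒¬Any)
open import Data.List.Relation.Unary.AllPairs as AllPairs using (AllPairs; _∷_)
open import Data.List.Relation.Unary.Any using (here; there)
open import Data.List.Relation.Unary.Linked.Properties using (Linked⇒AllPairs)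
open import Data.List.Relation.Unary.Unique.Propositional using (Unique)
open import Data.List.Relation.Unary.Unique.Propositional.Properties using (allFin⁺)
import Data.List.Sort.InsertionSort as InsertionSort
import Data.List.Sort.InsertionSort.Properties as InsertionSortProperties
open import Data.Nat using (ℕ; zero; suc; _+_; _*_; _≤_; _<_; z≤n; s≤s)
open import Data.Nat.ListAction using (sum)
open import Data.Nat.ListAction.Properties using (sum-↭)
open import Data.Nat.Properties as ℕ using (+-mono-≤; module ≤-Reasoning)
open import Algebra.Properties.CommutativeSemigroup ℕ.+-commutativeSemigroup using (interchange)
open import Data.Product using (∃-syntax; _×_; _,_; proj₂)
open import Data.Product.Relation.Binary.Lex.Strict using (×-Lex; ×-transitive; ×-antisymmetric; ×-total₂)
open import Data.Sum using (inj₁; inj₂)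
open import Data.Vec using (Vec; []; _∷_; lookup; toList)
open import Data.Vec.Properties using () renaming (≡-dec to ≡-decV)
open import Function using (_∘_; id)
open import Relation.Binary.Bundles using (DecTotalOrder)
open import Relation.Binary.Core using (Rel)
open import Relation.Binary.Definitions
  using (Antisymmetric; Asymmetric; DecidableEquality; Irreflexive; Total; Transitive; Trichotomous; tri<; tri≈; tri>)
import Relation.Binary.Properties.DecTotalOrder as DecTotalOrderProperties
open import Relation.Binary.PropositionalEquality
open import Relation.Nullary using (Dec; yes; no; contradiction)
open import Relation.Nullary.Decidable using (⌊_⌋; map′; T?)

open import Defs

sum-map-≤ : ∀ {X : Set} (f : X → ℕ) {c} → (∀ x → f x ≤ c) → ∀ xs → sum (map f xs) ≤ length xs * c
sum-map-≤ f f≤c []       = z≤n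
sum-map-≤ f f≤c (x ∷ xs) = +-mono-≤ (f≤c x) (sum-map-≤ f f≤c xs)

toList≡tabulate-lookup : ∀ {A : Set} {m} (v : Vec A m) → toList v ≡ tabulate (lookup v)
toList≡tabulate-lookup []       = refl
toList≡tabulate-lookup (x ∷ xs) = cong (x ∷_) (toList≡tabulate-lookup xs)

module _ {A : Set} (_≟_ : DecidableEquality A) where

  runs≤1+changes : ∀ xs → runs _≟_ xs ≤ suc (changes _≟_ xs)
  runs≤1+changes []      = z≤n
  runs≤1+changes (_ ∷ _) = ℕ.≤-refl

module _ {A B : Set} (_≟A_ : DecidableEquality A) (_≟B_ : DecidableEquality B) (f : A → B) where

  changesFrom-map-≤ : ∀ x ys → changesFrom _≟B_ (f x) (map f ys) ≤ changesFrom _≟A_ x ys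
  changesFrom-map-≤ x []       = z≤n
  changesFrom-map-≤ x (y ∷ ys) = +-mono-≤ (change-≤ (f x ≟B f y) (x ≟A y)) (changesFrom-map-≤ y ys)
    where
    change-≤ : (fx≟fy : Dec (f x ≡ f y)) (x≟y : Dec (x ≡ y)) →
               (if ⌊ fx≟fy ⌋ then 0 else 1) ≤ (if ⌊ x≟y ⌋ then 0 else 1)
    change-≤ (yes _)    _         = z≤n
    change-≤ (no _)     (no _)    = ℕ.≤-refl
    change-≤ (no fx≢fy) (yes x≡y) = contradiction (cong f x≡y) fx≢fy

  changes-map-≤ : ∀ xs → changes _≟B_ (map f xs) ≤ changes _≟A_ xs
  changes-map-≤ []       = z≤n
  changes-map-≤ (x ∷ xs) = changesFrom-map-≤ x xs

Infix-head-∈ : ∀ {a} {A : Set a} {x : A} {xs ys} → Infix _≡_ (x ∷ xs) ys → x ∈ ys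
Infix-head-∈ (here (refl ∷ _)) = here refl
Infix-head-∈ (there inf)       = there (Infix-head-∈ inf)

module _ {a ℓ} {A : Set a} {_<_ : Rel A ℓ} (<-asym : Asymmetric _<_) where

  adjacent-if-nothing-between : ∀ {x y xs} → AllPairs _<_ xs → x ∈ xs → y ∈ xs → x < y →
                                (∀ {z} → x < z → z < y → ⊥) → Infix _≡_ (x ∷ y ∷ []) xs
  adjacent-if-nothing-between _ (here refl) (here refl) x<x _ = contradiction x<x (<-asym x<x)
  adjacent-if-nothing-between {xs = _ ∷ _ ∷ _} _ (here refl) (there (here refl)) _ _ =
    here (refl ∷ refl ∷ [])
  adjacent-if-nothing-between {xs = _ ∷ _ ∷ _} ((x<z ∷ _) ∷ (z<zs ∷ _)) (here refl) (there (there y∈zs))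
                              _ between =
    contradiction (All.lookup z<zs y∈zs) (between x<z)
  adjacent-if-nothing-between (y<xs ∷ _) (there x∈xs) (here refl) x<y _ =
    contradiction x<y (<-asym (All.lookup y<xs x∈xs))
  adjacent-if-nothing-between (_ ∷ sorted) (there x∈xs) (there y∈xs) x<y between =
    there (adjacent-if-nothing-between sorted x∈xs y∈xs x<y between)

module _ {A : Set} (_≟_ : DecidableEquality A) where

  private
    change : A → A → ℕ
    change x y = if ⌊ x ≟ y ⌋ then 0 else 1

    agreement : A → A → ℕ
    agreement x y = if ⌊ x ≟ y ⌋ then 1 else 0

    change+agreement≡1 : ∀ x y → change x y + agreement x y ≡ 1
    change+agreement≡1 x y with x ≟ y
    ... | yes _ = refl
    ... | no _  = refl

    change≤1 : ∀ x y → change x y ≤ 1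
    change≤1 x y with x ≟ y
    ... | yes _ = z≤n
    ... | no _  = ℕ.≤-refl

    change-≡ : ∀ {x y} → x ≡ y → change x y ≡ 0
    change-≡ {x} refl with x ≟ x
    ... | yes _   = refl
    ... | no x≢x = contradiction refl x≢x

  linkedToNext : ∀ {n} → (Fin (suc n) → A) → Fin (suc n) → ℕ
  linkedToNext {zero}  g zero    = 0
  linkedToNext {suc n} g zero    = agreement (g zero) (g (suc zero))
  linkedToNext {suc n} g (suc x) = linkedToNext (g ∘ suc) x

  data LinkView {n} (g : Fin (suc n) → A) (x : Fin (suc n)) : ℕ → Set where
    unlinked : LinkView g x 0
    linked   : ∀ i → x ≡ inject₁ i → g x ≡ g (suc i) → LinkView g x 1

  linkView : ∀ {n} (g : Fin (suc n) → A) x → LinkView g x (linkedToNext g x)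
  linkView {zero}  g zero = unlinked
  linkView {suc n} g zero with g zero ≟ g (suc zero)
  ... | yes g₀≡g₁ = linked zero refl g₀≡g₁
  ... | no _      = unlinked
  linkView {suc n} g (suc x) with linkedToNext (g ∘ suc) x | linkView (g ∘ suc) x
  ... | _ | unlinked          = unlinked
  ... | _ | linked i refl eq = linked (suc i) refl eq

  changes+linkedToNext≡ : ∀ {n} (g : Fin (suc n) → A) →
                          changes _≟_ (tabulate g) + sum (tabulate (linkedToNext g)) ≡ n
  changes+linkedToNext≡ {zero}  g = refl
  changes+linkedToNext≡ {suc n} g = begin
    (change g₀ g₁ + changes _≟_ (tabulate g′)) + (agreement g₀ g₁ + sum (tabulate (linkedToNext g′)))
      ≡⟨ interchange (change g₀ g₁) _ (agreement g₀ g₁) _ ⟩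
    (change g₀ g₁ + agreement g₀ g₁) + (changes _≟_ (tabulate g′) + sum (tabulate (linkedToNext g′)))
      ≡⟨ cong₂ _+_ (change+agreement≡1 g₀ g₁) (changes+linkedToNext≡ g′) ⟩
    suc n ∎
    where
    open ≡-Reasoning
    g₀ = g zero
    g₁ = g (suc zero)
    g′ = g ∘ suc

  LinksKept : ∀ {n} → (Fin (suc n) → A) → List (Fin (suc n)) → Set
  LinksKept g xs = ∀ i → g (inject₁ i) ≡ g (suc i) → inject₁ i ∈ xs →
                   Infix _≡_ (inject₁ i ∷ suc i ∷ []) xs

  module _ {n} (g : Fin (suc n) → A) {x ys} (x∉ys : x ∉ ys) (kept : LinksKept g (x ∷ ys)) where

    LinksKept-tail : LinksKept g ys
    LinksKept-tail i eq i∈ys with kept i eq (there i∈ys)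
    ... | here (refl ∷ _) = contradiction i∈ys x∉ys
    ... | there inf       = inf

    followed-by-successor : ∀ i → x ≡ inject₁ i → g x ≡ g (suc i) → ∃[ zs ] ys ≡ suc i ∷ zs
    followed-by-successor i refl eq with kept i eq (here refl)
    ... | here (refl ∷ refl ∷ []) = _ , refl
    ... | there inf               = contradiction (Infix-head-∈ inf) x∉ys

  changesFrom+linkedToNext≤ : ∀ {n} (g : Fin (suc n) → A) x ys → Unique (x ∷ ys) → LinksKept g (x ∷ ys) →
                              changesFrom _≟_ (g x) (map g ys) + sum (map (linkedToNext g) (x ∷ ys)) ≤ length ys
  changesFrom+linkedToNext≤ g x [] (x∉ys ∷ _) kept with linkedToNext g x | linkView g x
  ... | _ | unlinked = z≤n
  ... | _ | linked i x≡i eq with () ← followed-by-successor g (All¬⇒¬Any x∉ys) kept i x≡i eq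
  changesFrom+linkedToNext≤ g x (y ∷ zs) (x∉ys ∷ unique) kept = begin
    (change (g x) (g y) + Cs) + (linkedToNext g x + Ws) ≡⟨ interchange (change (g x) (g y)) Cs _ Ws ⟩
    (change (g x) (g y) + linkedToNext g x) + (Cs + Ws) ≤⟨ +-mono-≤ head-bound tail-bound ⟩
    1 + length zs                                       ∎
    where
    open ≤-Reasoning
    Cs = changesFrom _≟_ (g y) (map g zs)
    Ws = sum (map (linkedToNext g) (y ∷ zs))
    tail-bound : Cs + Ws ≤ length zs
    tail-bound = changesFrom+linkedToNext≤ g y zs unique (LinksKept-tail g (All¬⇒¬Any x∉ys) kept)
    head-bound : change (g x) (g y) + linkedToNext g x ≤ 1
    head-bound with linkedToNext g x | linkView g x
    ... | _ | unlinked = ℕ.≤-trans (ℕ.≤-reflexive (ℕ.+-identityʳ _)) (change≤1 (g x) (g y))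
    ... | _ | linked i x≡i eq with followed-by-successor g (All¬⇒¬Any x∉ys) kept i x≡i eq
    ...   | _ , refl = ℕ.≤-reflexive (cong (_+ 1) (change-≡ eq))

  changes-≤-if-LinksKept : ∀ {n} (g : Fin (suc n) → A) {P} → P ↭ allFin (suc n) → LinksKept g P →
                           changes _≟_ (map g P) ≤ changes _≟_ (tabulate g)
  changes-≤-if-LinksKept g {[]} P↭ _ = contradiction (↭-sym P↭) ¬x∷xs↭[]
  changes-≤-if-LinksKept {n} g {x ∷ ys} P↭ kept = ℕ.+-cancelʳ-≤ links _ _ (begin
    changesFrom _≟_ (g x) (map g ys) + links
      ≡⟨ cong (changesFrom _≟_ (g x) (map g ys) +_) links-↭ ⟨
    changesFrom _≟_ (g x) (map g ys) + sum (map (linkedToNext g) (x ∷ ys))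
      ≤⟨ changesFrom+linkedToNext≤ g x ys unique kept ⟩
    length ys
      ≡⟨ ℕ.suc-injective (trans (↭-length P↭) (length-tabulate {n = suc n} id)) ⟩
    n
      ≡⟨ changes+linkedToNext≡ g ⟨
    changes _≟_ (tabulate g) + links
      ∎)
    where
    open ≤-Reasoning
    links = sum (tabulate (linkedToNext g))
    links-↭ : sum (map (linkedToNext g) (x ∷ ys)) ≡ links
    links-↭ = trans (sum-↭ (map⁺ (linkedToNext g) P↭)) (cong sum (map-tabulate id (linkedToNext g)))
    unique : Unique (x ∷ ys)
    unique = PermutationSetoid.Unique-resp-↭ (setoid _) (↭⇒↭ₛ (↭-sym P↭)) (allFin⁺ (suc n))

module _ {σ : ℕ} where

  infix 4 _<ₗ_
  _<ₗ_ : Rel (List (Fin σ)) _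
  _<ₗ_ = Lex-< _≡_ Fin._<_

  lexLt-sound : ∀ {xs ys} → T (lexLt xs ys) → xs <ₗ ys
  lexLt-sound {[]}     {_ ∷ _}  _ = halt
  lexLt-sound {x ∷ xs} {y ∷ ys} t with x Fin.<? y | x Fin.≟ y
  ... | yes x<y | _        = this x<y
  ... | no _    | yes refl = next refl (lexLt-sound t)

  lexLt-complete : ∀ {xs ys} → xs <ₗ ys → T (lexLt xs ys)
  lexLt-complete halt = _
  lexLt-complete (this {x} {y = y} x<y) with x Fin.<? y
  ... | yes _   = _
  ... | no x≮y = contradiction x<y x≮y
  lexLt-complete (next {x} refl xs<ys) with x Fin.<? x | x Fin.≟ x
  ... | yes _ | _       = _
  ... | no _  | yes _   = lexLt-complete xs<ys
  ... | no _  | no x≢x = contradiction refl x≢x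

  <ₗ-irrefl : Irreflexive _≡_ _<ₗ_
  <ₗ-irrefl xs≡ys = Lex.<-irreflexive Fin.<-irrefl (≡⇒Pointwise-≡ xs≡ys)

  <ₗ-asym : Asymmetric _<ₗ_
  <ₗ-asym = Lex.<-asymmetric sym Fin.<-resp₂-≡ Fin.<-asym

  <ₗ-trans : Transitive _<ₗ_
  <ₗ-trans = Lex.<-transitive isEquivalence Fin.<-resp₂-≡ Fin.<-trans

  <ₗ-cmp : Trichotomous _≡_ _<ₗ_
  <ₗ-cmp xs ys with Lex.<-compare sym Fin.<-cmp xs ys
  ... | tri< lt ne gt = tri< lt (ne ∘ ≡⇒Pointwise-≡) gt
  ... | tri≈ lt eq gt = tri≈ lt (Pointwise-≡⇒≡ eq) gt
  ... | tri> lt ne gt = tri> lt (ne ∘ ≡⇒Pointwise-≡) gt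

module ColumnOrder {σ h w : ℕ} (S : Haplotypes σ h w) (j : Fin w) where

  tag : Fin h → List (Fin σ) × Fin h
  tag k = key S j k , k

  infix 4 _≼_
  _≼_ : Rel (Fin h) _
  a ≼ b = ×-Lex _≡_ _<ₗ_ Fin._≤_ (tag a) (tag b)

  before-sound : ∀ {a b} → T (before S j a b) → a ≼ b
  before-sound {a} {b} t with lexLt (key S j a) (key S j b) in lexLt≡true
  ... | true  = inj₁ (lexLt-sound (subst T (sym lexLt≡true) _))
  ... | false with ≡-decL Fin._≟_ (key S j a) (key S j b) | a Fin.≤? b
  ...   | yes same | yes a≤b = inj₂ (same , a≤b)

  before-complete : ∀ {a b} → a ≼ b → T (before S j a b)
  before-complete {a} {b} (inj₁ keys<) with lexLt (key S j a) (key S j b) | lexLt-complete keys<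
  ... | true | _ = _
  before-complete {a} {b} (inj₂ (same , a≤b)) with lexLt (key S j a) (key S j b)
  ... | true  = _
  ... | false with ≡-decL Fin._≟_ (key S j a) (key S j b) | a Fin.≤? b
  ...   | yes _     | yes _  = _
  ...   | no differ | _      = contradiction same differ
  ...   | yes _     | no a≰b = contradiction a≤b a≰b

  ≼-trans : Transitive _≼_
  ≼-trans {a} {b} {c} = ×-transitive isEquivalence (resp₂ _<ₗ_) <ₗ-trans Fin.≤-trans {tag a} {tag b} {tag c}

  ≼-antisym : Antisymmetric _≡_ _≼_
  ≼-antisym {a} {b} a≼b b≼a = proj₂ (×-antisymmetric {_≈₁_ = _≡_} {_<₁_ = _<ₗ_} {_≈₂_ = _≡_}
    sym <ₗ-irrefl <ₗ-asym Fin.≤-antisym {tag a} {tag b} a≼b b≼a)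

  ≼-total : Total _≼_
  ≼-total a b = ×-total₂ sym <ₗ-cmp Fin.≤-total (tag a) (tag b)

  -- The decision procedure is T? ∘ before, so insertion sort for this order is literally isort.
  ≼-decTotalOrder : DecTotalOrder _ _ _
  ≼-decTotalOrder = record
    { Carrier         = Fin h
    ; _≈_             = _≡_
    ; _≤_             = _≼_
    ; isDecTotalOrder = record
      { isTotalOrder = record
        { isPartialOrder = record
          { isPreorder = record
            { isEquivalence = isEquivalence
            ; reflexive     = λ { {a} refl → inj₂ (refl {x = key S j a} , Fin.≤-refl) }
            ; trans         = ≼-trans
            }
          ; antisym = ≼-antisym
          }
        ; total = ≼-total
        }
      ; _≟_  = Fin._≟_
      ; _≤?_ = λ a b → map′ before-sound before-complete (T? (before S j a b))
      }
    }

  open InsertionSort ≼-decTotalOrder using (sort)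
  open InsertionSortProperties ≼-decTotalOrder using (sort-↭; sort-↗)
  open DecTotalOrderProperties ≼-decTotalOrder using () renaming (_<_ to _≺_; <-asym to ≺-asym)

  isort≡sort : ∀ xs → isort S j xs ≡ sort xs
  isort≡sort []       = refl
  isort≡sort (x ∷ xs) = trans (cong (insert S j x) (isort≡sort xs)) (insert≡ (sort xs))
    where
    insert≡ : ∀ ys → insert S j x ys ≡ InsertionSort.insert ≼-decTotalOrder x ys
    insert≡ []       = refl
    insert≡ (y ∷ ys) = cong (λ t → if before S j x y then x ∷ y ∷ ys else y ∷ t) (insert≡ ys)

  PAcol-↭ : PAcol S j ↭ allFin h
  PAcol-↭ = subst (_↭ allFin h) (sym (isort≡sort (allFin h))) (sort-↭ (allFin h))

  sort-strictly-sorted : AllPairs _≺_ (sort (allFin h))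
  sort-strictly-sorted = AllPairs.zip
    ( Linked⇒AllPairs ≼-trans (sort-↗ (allFin h))
    , PermutationSetoid.Unique-resp-↭ (setoid _) (↭⇒↭ₛ (↭-sym (sort-↭ (allFin h)))) (allFin⁺ h) )

  ≼-between-same-key : ∀ {a b c} → key S j a ≡ key S j c → a ≼ b → b ≼ c → a Fin.≤ b × b Fin.≤ c
  ≼-between-same-key a~c (inj₁ a<b)       (inj₁ b<c)       = contradiction (<ₗ-trans a<b b<c) (<ₗ-irrefl a~c)
  ≼-between-same-key a~c (inj₁ a<b)       (inj₂ (b~c , _)) = contradiction a<b (<ₗ-irrefl (trans a~c (sym b~c)))
  ≼-between-same-key a~c (inj₂ (a~b , _)) (inj₁ b<c)       = contradiction b<c (<ₗ-irrefl (trans (sym a~b) a~c))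
  ≼-between-same-key _   (inj₂ (_ , a≤b)) (inj₂ (_ , b≤c)) = a≤b , b≤c

  PAcol-adjacent : ∀ {a b} → key S j a ≡ key S j b → toℕ b ≡ suc (toℕ a) →
                   Infix _≡_ (a ∷ b ∷ []) (PAcol S j)
  PAcol-adjacent {a} {b} a~b b≡1+a = subst (Infix _≡_ (a ∷ b ∷ [])) (sym (isort≡sort (allFin h)))
    (adjacent-if-nothing-between ≺-asym sort-strictly-sorted (∈-sort a) (∈-sort b) a≺b nothing-between)
    where
    a<b : a Fin.< b
    a<b = subst (toℕ a <_) (sym b≡1+a) (ℕ.n<1+n (toℕ a))
    a≺b : a ≺ b
    a≺b = inj₂ (a~b , ℕ.<⇒≤ a<b) , Fin.<⇒≢ a<b
    nothing-between : ∀ {z} → a ≺ z → z ≺ b → ⊥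
    nothing-between (a≼z , a≢z) (z≼b , z≢b) with ≼-between-same-key a~b a≼z z≼b
    ... | a≤z , z≤b =
      ℕ.<⇒≱ (Fin.≤∧≢⇒< a≤z a≢z) (ℕ.≤-pred (subst (toℕ _ <_) b≡1+a (Fin.≤∧≢⇒< z≤b z≢b)))
    ∈-sort : ∀ k → k ∈ sort (allFin h)
    ∈-sort k = ∈-resp-↭ (↭-sym (sort-↭ (allFin h))) (∈-allFin k)

PAcol-keeps-links : ∀ {σ n w} (S : Haplotypes σ (suc n) w) j → LinksKept (≡-decV Fin._≟_) (lookup S) (PAcol S j)
PAcol-keeps-links S j i Sᵢ≡Sᵢ₊₁ _ =
  ColumnOrder.PAcol-adjacent S j (cong (λ v → revPrefix v j) Sᵢ≡Sᵢ₊₁) (cong suc (sym (toℕ-inject₁ i)))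

column-runs-≤ : ∀ {σ h w} (S : Haplotypes σ h w) j → rcol S j ≤ h'' S + 1
column-runs-≤ {h = zero}  S j = z≤n
column-runs-≤ {h = suc n} S j = begin
  rcol S j                                           ≤⟨ runs≤1+changes Fin._≟_ (PBWTcol S j) ⟩
  suc (changes Fin._≟_ (map (symbol ∘ lookup S) PA)) ≡⟨ cong (suc ∘ changes Fin._≟_) (map-∘ PA) ⟩
  suc (changes Fin._≟_ (map symbol haps))            ≤⟨ s≤s (changes-map-≤ _≟V_ Fin._≟_ symbol haps) ⟩
  suc (changes _≟V_ haps)                            ≤⟨ s≤s (changes-≤-if-LinksKept _≟V_ (lookup S) PAcol-↭ links) ⟩
  suc (changes _≟V_ (tabulate (lookup S)))           ≡⟨ cong (suc ∘ changes _≟V_) (toList≡tabulate-lookup S) ⟨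
  suc (h'' S)                                        ≡⟨ ℕ.+-comm 1 (h'' S) ⟩
  h'' S + 1                                          ∎
  where
  open ≤-Reasoning
  open ColumnOrder S j using (PAcol-↭)
  PA = PAcol S j
  haps = map (lookup S) PA
  _≟V_ = ≡-decV Fin._≟_
  symbol = λ v → lookup v j
  links = PAcol-keeps-links S j

theorem1 : (σ h w : ℕ) (S : Haplotypes σ h w) → rTilde S ≤ w * (h'' S + 1)
theorem1 σ h w S = begin
  rTilde S                         ≤⟨ sum-map-≤ (rcol S) (column-runs-≤ S) (allFin w) ⟩
  length (allFin w) * (h'' S + 1)  ≡⟨ cong (_* (h'' S + 1)) (length-tabulate {n = w} id) ⟩
  w * (h'' S + 1)                  ∎
  where open ≤-Reasoning
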